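{- Let $t$ be a tuple containing no occurrences of the operators $\cdot$ and $\mathit{aop}$, let $\tau$ be a product type, $T$ a template and $\Gamma$ a typing environment such that $[]\vdash t\triangleright\tau$ and $\tau\vdash T\triangleright\Gamma$. Then $t/T\neq\mathit{err}$. Moreover: (1) if $\Gamma\vdash\psi\triangleright\mathit{Bool}$ and $\mathrm{BV}(T)\supseteq\mathrm{FV}(\psi)$, then $[\![\psi(t/T)]\!]\neq\mathit{err}$; (2) if $\Gamma\vdash t'\triangleright\tau'$ and $\mathrm{BV}(T)\supseteq\mathrm{FV}(t')$, then $[\![t'(t/T)]\!]\Vdash\tau'$.
   Context: Syntax. Fix integers $\mathit{num}$, strings $\mathit{str}$, table identifiers $\mathit{tid}$, localities $l$, data variables $x$, locality variables $u$. Expressions: $e ::= \mathit{num}\mid\mathit{str}\mid\mathit{tid}\mid l\mid x\mid u\mid e_1\cdot e_2\mid e_1\,\mathit{aop}\,e_2\mid\{e_1,\dots,e_n\}$ ($n\ge 0$), with $\cdot$ string concatenation, $\mathit{aop}$ binary arithmetic operators on integers (total; division by zero yields $0$), $\{e_1,\dots,e_n\}$ a multiset whose elements contain no multisets. Predicates: $\psi::=\mathsf{true}\mid e_1\,\mathit{cop}\,e_2\mid e_1\in e_2\mid\neg\psi\mid\psi_1\wedge\psi_2$ ($\mathit{cop}$: equality on integers, strings, localities; orderings on integers and strings). Tuples $t::=e_1,\dots,e_n$ ($n>0$). Templates $T::=W_1,\dots,W_n$ ($n>0$), $W::=\,!x\mid\,!u$, linear; $\mathrm{BV}(T)$ is the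 set of variables occurring in $T$, $\mathrm{FV}(\cdot)$ the free variables. Types: $\tau_d::=\mathit{Int}\mid\mathit{String}\mid\mathit{Loc}\mid\mathit{Id}$; $\tau_m::=\{\tau_d\}\mid\tau_d$ (multiset types or data types); product types $\tau_m^1\times\dots\times\tau_m^n$; one-component tuples/products are identified with their component. Evaluation (values: integers, strings, table identifiers, localities, multisets of these): constants evaluate to themselves; variables evaluate to $\mathit{err}$; $[\![e_1\cdot e_2]\!]$ concatenates if both evaluate to strings, else $\mathit{err}$; $[\![e_1\,\mathit{aop}\,e_2]\!]$ computes if both evaluate to integers, else $\mathit{err}$; $[\![\{e_1,\dots,e_n\}]\!]=\{[\![e_1]\!],\dots,[\![e_n]\!]\}$ if all are values of one type $\tau_d$, else $\mathit{err}$. Predicates: $[\![\mathsf{true}]\!]=\mathit{tt}$; $[\![e_1\,\mathit{cop}\,e_2]\!]$ is the comparison result if both sides evaluate to values of the same $\tau_d$, else $\mathit{err}$; $[\![e_1\in e_2]\!]$ is the membership result if $[\![e_2]\!]$ is a multiset of values of the type of $[\![e_1]\!]$, else $\mathit{err}$; $\neg$ swaps $\mathit{tt},\mathit{ff}$ and preserves $\mathit{err}$; $[\![\psi_1\wedge\psi_2]\!]$ is $\mathit{tt}$ if both $\mathit{tt}$, $\mathit{err}$ if either is $\mathit{err}$, else $\mathit{ff}$. Tuples evaluate componentwise, to $\mathit{err}$ if some component does. Well-sortedness of values: $\mathit{num}\Vdash\mathit{Int}$, $\mathit{str}\Vdash\mathit{String}$, $\mathit{tid}\Vdash\mathit{Id}$,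 $l\Vdash\mathit{Loc}$, $\{v_1,\dots,v_n\}\Vdash\{\tau_d\}$ if each $v_i\Vdash\tau_d$, and $v_1,\dots,v_n\Vdash\tau_1\times\dots\times\tau_n$ if each $v_i\Vdash\tau_i$. Pattern matching $t/T$ (yielding a substitution or $\mathit{err}$): for $\mathit{val}$ an integer, string or table identifier, $\mathit{val}/!x=[\mathit{val}/x]$ and $\mathit{val}/!u=\mathit{err}$; for a multiset $M$ of integers, of strings, of table identifiers, or of localities, $M/!x=[M/x]$ and $M/!u=\mathit{err}$; $l/!u=[l/u]$ and $l/!x=\mathit{err}$; $(e_1,\dots,e_n)/(W_1,\dots,W_m)=\sigma_1\cdots\sigma_m$ if $m=n$ and each $e_j/W_j=\sigma_j\neq\mathit{err}$, and $\mathit{err}$ otherwise. $\psi\sigma$, $t'\sigma$ denote application of a substitution $\sigma$. Typing. A typing environment is a finite sequence of bindings of variables to types, at most one per variable; $[]$ is empty. Expressions: $\Gamma\vdash x\triangleright\tau$ if $\Gamma(x)=\tau\neq\mathit{Loc}$; $\Gamma\vdash u\triangleright\mathit{Loc}$ if $\Gamma(u)=\mathit{Loc}$; $\mathit{num}\triangleright\mathit{Int}$, $\mathit{str}\triangleright\mathit{String}$, $\mathit{tid}\triangleright\mathit{Id}$, $l\triangleright\mathit{Loc}$; $e_1\cdot e_2\triangleright\mathit{String}$ if both $e_i\triangleright\mathit{String}$; $e_1\,\mathit{aop}\,e_2\triangleright\mathit{Int}$ if both $e_i\triangleright\mathit{Int}$; $\{e_1,\dots,e_n\}\triangleright\{\tau_d\}$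 if every $e_i\triangleright\tau_d$. Predicates: $\mathsf{true}\triangleright\mathit{Bool}$; $e_1\,\mathit{cop}\,e_2\triangleright\mathit{Bool}$ if both have a common type $\tau_d$; $e_1\in e_2\triangleright\mathit{Bool}$ if $e_1\triangleright\tau_d$ and $e_2\triangleright\{\tau_d\}$; $\neg\psi$, $\psi_1\wedge\psi_2$ are $\mathit{Bool}$ if their subpredicates are. Tuples: $e_1,\dots,e_n\triangleright\tau_1\times\dots\times\tau_n$ if $e_i\triangleright\tau_i$. Templates: $\tau_m\vdash\,!x\triangleright[x:\tau_m]$ if $\tau_m\neq\mathit{Loc}$; $\mathit{Loc}\vdash\,!u\triangleright[u:\mathit{Loc}]$; $\tau_1\times\dots\times\tau_n\vdash W_1,\dots,W_n\triangleright\Gamma_1,\dots,\Gamma_n$ if $\tau_i\vdash W_i\triangleright\Gamma_i$ for all $i$. -}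

module Defs where

open import Data.Bool using (Bool; true; false; _∧_; not; if_then_else_)
open import Data.Nat as ℕ using (ℕ)
open import Data.Integer as ℤ using (ℤ)
open import Data.String as Str using (String)
import Data.String.Properties as StrP
open import Data.List using (List; []; _∷_; _++_; [_])
open import Data.Bool.ListAction using (any; all)
open import Data.List.NonEmpty as L⁺ using (List⁺; _∷_; toList)
open import Data.List.Relation.Unary.All using (All)
open import Data.List.Relation.Binary.Pointwise using (Pointwise)
open import Data.List.Relation.Unary.Unique.Propositional using (Unique)
open import Data.Maybe using (Maybe; just; nothing)
open import Data.Product using (_×_; _,_)
open import Relation.Nullary using (does; ¬_)
open import Relation.Binary.PropositionalEquality using (_≡_; _≢_)

-- Data variables x (dv) and locality variables u (lv), two disjoint sorts.
data Var : Set where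
  dv : ℕ → Var
  lv : ℕ → Var

_==ᵥ_ : Var → Var → Bool
dv m ==ᵥ dv n = does (m ℕ.≟ n)
lv m ==ᵥ lv n = does (m ℕ.≟ n)
_    ==ᵥ _    = false

-- Expressions.  Table identifiers and localities are drawn from ℕ.
-- An arithmetic operator is any (total) binary operation on integers
-- (e.g. division with division by zero yielding 0).
data Expr : Set where
  num  : ℤ → Expr
  str  : String → Expr
  tid  : ℕ → Expr
  loc  : ℕ → Expr
  var  : Var → Expr
  _·_  : Expr → Expr → Expr
  aop  : (ℤ → ℤ → ℤ) → Expr → Expr → Expr
  mset : List Expr → Expr

data Cop : Set where
  eq lt le : Cop

data Pred : Set where
  ptrue : Pred
  cmp   : Cop → Expr → Expr → Pred
  mem   : Expr → Expr → Pred
  pnot  : Pred → Pred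
  pand  : Pred → Pred → Pred

Tuple : Set
Tuple = List⁺ Expr

data W : Set where
  bx : ℕ → W     -- !x
  bu : ℕ → W     -- !u

Template : Set
Template = List⁺ W

bvW : W → Var
bvW (bx n) = dv n
bvW (bu n) = lv n

BV : Template → List Var
BV T = Data.List.map bvW (toList T)
  where import Data.List

Linear : Template → Set
Linear T = Unique (BV T)

mutual
  fvE : Expr → List Var
  fvE (var v)      = [ v ]
  fvE (e₁ · e₂)    = fvE e₁ ++ fvE e₂
  fvE (aop _ e₁ e₂) = fvE e₁ ++ fvE e₂
  fvE (mset es)    = fvL es
  fvE _            = []

  fvL : List Expr → List Var
  fvL []       = []
  fvL (e ∷ es) = fvE e ++ fvL es

fvP : Pred → List Var
fvP ptrue          = []
fvP (cmp _ e₁ e₂)  = fvE e₁ ++ fvE e₂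
fvP (mem e₁ e₂)    = fvE e₁ ++ fvE e₂
fvP (pnot ψ)       = fvP ψ
fvP (pand ψ₁ ψ₂)   = fvP ψ₁ ++ fvP ψ₂

fvT : Tuple → List Var
fvT t = fvL (toList t)

data NoOp : Expr → Set where
  no-num  : ∀ {n} → NoOp (num n)
  no-str  : ∀ {s} → NoOp (str s)
  no-tid  : ∀ {i} → NoOp (tid i)
  no-loc  : ∀ {l} → NoOp (loc l)
  no-var  : ∀ {v} → NoOp (var v)
  no-mset : ∀ {es} → All NoOp es → NoOp (mset es)

data DType : Set where
  Int Str Loc Id : DType

data MType : Set where
  base : DType → MType
  mty  : DType → MType       -- multiset type {τ_d}

Prod : Set
Prod = List⁺ MType

-- Values and evaluation (nothing = err)

data DVal : Set where
  vnum : ℤ → DVal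
  vstr : String → DVal
  vtid : ℕ → DVal
  vloc : ℕ → DVal

data Val : Set where
  dval : DVal → Val
  mval : List DVal → Val      -- multisets (as lists; only membership is observed)

dtypeOf : DVal → DType
dtypeOf (vnum _) = Int
dtypeOf (vstr _) = Str
dtypeOf (vtid _) = Id
dtypeOf (vloc _) = Loc

_==ᵗ_ : DType → DType → Bool
Int ==ᵗ Int = true
Str ==ᵗ Str = true
Loc ==ᵗ Loc = true
Id  ==ᵗ Id  = true
_   ==ᵗ _   = false

_==ᵈ_ : DVal → DVal → Bool
vnum a ==ᵈ vnum b = does (a ℤ.≟ b)
vstr a ==ᵈ vstr b = does (a StrP.≟ b)
vtid a ==ᵈ vtid b = does (a ℕ.≟ b)
vloc a ==ᵈ vloc b = does (a ℕ.≟ b)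
_      ==ᵈ _      = false

allOf : DType → List DVal → Bool
allOf τ vs = all (λ v → dtypeOf v ==ᵗ τ) vs

homogeneous : List DVal → Bool
homogeneous []       = true
homogeneous (v ∷ vs) = allOf (dtypeOf v) vs

mutual
  eval : Expr → Maybe Val
  eval (num n) = just (dval (vnum n))
  eval (str s) = just (dval (vstr s))
  eval (tid i) = just (dval (vtid i))
  eval (loc l) = just (dval (vloc l))
  eval (var _) = nothing
  eval (e₁ · e₂) with eval e₁ | eval e₂
  ... | just (dval (vstr a)) | just (dval (vstr b)) = just (dval (vstr (a Str.++ b)))
  ... | _ | _ = nothing
  eval (aop f e₁ e₂) with eval e₁ | eval e₂
  ... | just (dval (vnum a)) | just (dval (vnum b)) = just (dval (vnum (f a b)))
  ... | _ | _ = nothing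
  eval (mset es) with evalElems es
  ... | nothing = nothing
  ... | just vs = if homogeneous vs then just (mval vs) else nothing

  -- elements of a multiset must evaluate to data values (no nested multisets)
  evalElems : List Expr → Maybe (List DVal)
  evalElems [] = just []
  evalElems (e ∷ es) with eval e | evalElems es
  ... | just (dval v) | just vs = just (v ∷ vs)
  ... | _ | _ = nothing

compareD : Cop → DVal → DVal → Maybe Bool
compareD eq (vnum a) (vnum b) = just (does (a ℤ.≟ b))
compareD eq (vstr a) (vstr b) = just (does (a StrP.≟ b))
compareD eq (vloc a) (vloc b) = just (does (a ℕ.≟ b))
compareD lt (vnum a) (vnum b) = just (does (a ℤ.<? b))
compareD lt (vstr a) (vstr b) = just (does (a StrP.<? b))
compareD le (vnum a) (vnum b) = just (does (a ℤ.≤? b))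
compareD le (vstr a) (vstr b) = just (does (a StrP.<? b) Data.Bool.∨ does (a StrP.≟ b))
  where import Data.Bool
compareD _ _ _ = nothing

evalP : Pred → Maybe Bool
evalP ptrue = just true
evalP (cmp c e₁ e₂) with eval e₁ | eval e₂
... | just (dval a) | just (dval b) = compareD c a b
... | _ | _ = nothing
evalP (mem e₁ e₂) with eval e₁ | eval e₂
... | just (dval a) | just (mval ms) =
        if allOf (dtypeOf a) ms then just (any (λ m → a ==ᵈ m) ms) else nothing
... | _ | _ = nothing
evalP (pnot ψ) with evalP ψ
... | just b  = just (not b)
... | nothing = nothing
evalP (pand ψ₁ ψ₂) with evalP ψ₁ | evalP ψ₂
... | just a | just b = just (a ∧ b)
... | _ | _ = nothing

evalL : List Expr → Maybe (List Val)
evalL [] = just []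
evalL (e ∷ es) with eval e | evalL es
... | just v | just vs = just (v ∷ vs)
... | _ | _ = nothing

evalT : Tuple → Maybe (List⁺ Val)
evalT (e ∷ es) with eval e | evalL es
... | just v | just vs = just (v ∷ vs)
... | _ | _ = nothing

data _⊩ᵈ_ : DVal → DType → Set where
  ws-num : ∀ {n} → vnum n ⊩ᵈ Int
  ws-str : ∀ {s} → vstr s ⊩ᵈ Str
  ws-tid : ∀ {i} → vtid i ⊩ᵈ Id
  ws-loc : ∀ {l} → vloc l ⊩ᵈ Loc

data _⊩_ : Val → MType → Set where
  ws-d : ∀ {v τ} → v ⊩ᵈ τ → dval v ⊩ base τ
  ws-m : ∀ {vs τ} → All (_⊩ᵈ τ) vs → mval vs ⊩ mty τ

_⊩ₜ_ : List⁺ Val → Prod → Set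
vs ⊩ₜ τs = Pointwise _⊩_ (toList vs) (toList τs)

Subst : Set
Subst = List (Var × Expr)

constSort : Expr → Maybe DType
constSort (num _) = just Int
constSort (str _) = just Str
constSort (tid _) = just Id
constSort (loc _) = just Loc
constSort _       = nothing

isSort : DType → Expr → Bool
isSort τ e with constSort e
... | just τ' = τ' ==ᵗ τ
... | nothing = false

isConstMset : List Expr → Bool
isConstMset []       = true
isConstMset (e ∷ es) with constSort e
... | just τ  = all (isSort τ) es
... | nothing = false

matchW : Expr → W → Maybe Subst
matchW (num n)   (bx x) = just [ (dv x , num n) ]
matchW (str s)   (bx x) = just [ (dv x , str s) ]
matchW (tid i)   (bx x) = just [ (dv x , tid i) ]
matchW (mset es) (bx x) = if isConstMset es then just [ (dv x , mset es) ] else nothing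
matchW (loc l)   (bu u) = just [ (lv u , loc l) ]
matchW _ _ = nothing

matchL : List Expr → List W → Maybe Subst
matchL [] [] = just []
matchL (e ∷ es) (w ∷ ws) with matchW e w | matchL es ws
... | just σ | just σ' = just (σ ++ σ')
... | _ | _ = nothing
matchL _ _ = nothing

_/_ : Tuple → Template → Maybe Subst
t / T = matchL (toList t) (toList T)

lookupS : Subst → Var → Maybe Expr
lookupS [] v = nothing
lookupS ((w , e) ∷ σ) v = if w ==ᵥ v then just e else lookupS σ v

mutual
  substE : Subst → Expr → Expr
  substE σ (var v) with lookupS σ v
  ... | just e  = e
  ... | nothing = var v
  substE σ (e₁ · e₂)      = substE σ e₁ · substE σ e₂
  substE σ (aop f e₁ e₂)  = aop f (substE σ e₁) (substE σ e₂)
  substE σ (mset es)      = mset (substL σ es)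
  substE σ e              = e

  substL : Subst → List Expr → List Expr
  substL σ []       = []
  substL σ (e ∷ es) = substE σ e ∷ substL σ es

substP : Subst → Pred → Pred
substP σ ptrue          = ptrue
substP σ (cmp c e₁ e₂)  = cmp c (substE σ e₁) (substE σ e₂)
substP σ (mem e₁ e₂)    = mem (substE σ e₁) (substE σ e₂)
substP σ (pnot ψ)       = pnot (substP σ ψ)
substP σ (pand ψ₁ ψ₂)   = pand (substP σ ψ₁) (substP σ ψ₂)

substT : Subst → Tuple → Tuple
substT σ (e ∷ es) = substE σ e ∷ substL σ es

Env : Set
Env = List (Var × MType)

lookupΓ : Env → Var → Maybe MType
lookupΓ [] v = nothing
lookupΓ ((w , τ) ∷ Γ) v = if w ==ᵥ v then just τ else lookupΓ Γ v

data _⊢_▹_ (Γ : Env) : Expr → MType → Set where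
  t-x    : ∀ {n τ} → lookupΓ Γ (dv n) ≡ just τ → τ ≢ base Loc → Γ ⊢ var (dv n) ▹ τ
  t-u    : ∀ {n} → lookupΓ Γ (lv n) ≡ just (base Loc) → Γ ⊢ var (lv n) ▹ base Loc
  t-num  : ∀ {n} → Γ ⊢ num n ▹ base Int
  t-str  : ∀ {s} → Γ ⊢ str s ▹ base Str
  t-tid  : ∀ {i} → Γ ⊢ tid i ▹ base Id
  t-loc  : ∀ {l} → Γ ⊢ loc l ▹ base Loc
  t-cat  : ∀ {e₁ e₂} → Γ ⊢ e₁ ▹ base Str → Γ ⊢ e₂ ▹ base Str → Γ ⊢ e₁ · e₂ ▹ base Str
  t-aop  : ∀ {f e₁ e₂} → Γ ⊢ e₁ ▹ base Int → Γ ⊢ e₂ ▹ base Int → Γ ⊢ aop f e₁ e₂ ▹ base Int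
  t-mset : ∀ {es τ} → All (λ e → Γ ⊢ e ▹ base τ) es → Γ ⊢ mset es ▹ mty τ

data CopOn : Cop → DType → Set where
  eq-int : CopOn eq Int
  eq-str : CopOn eq Str
  eq-loc : CopOn eq Loc
  lt-int : CopOn lt Int
  lt-str : CopOn lt Str
  le-int : CopOn le Int
  le-str : CopOn le Str

data _⊢ₚ_ (Γ : Env) : Pred → Set where
  tp-true : Γ ⊢ₚ ptrue
  tp-cmp  : ∀ {c e₁ e₂ τ} → CopOn c τ → Γ ⊢ e₁ ▹ base τ → Γ ⊢ e₂ ▹ base τ → Γ ⊢ₚ cmp c e₁ e₂
  tp-mem  : ∀ {e₁ e₂ τ} → Γ ⊢ e₁ ▹ base τ → Γ ⊢ e₂ ▹ mty τ → Γ ⊢ₚ mem e₁ e₂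
  tp-not  : ∀ {ψ} → Γ ⊢ₚ ψ → Γ ⊢ₚ pnot ψ
  tp-and  : ∀ {ψ₁ ψ₂} → Γ ⊢ₚ ψ₁ → Γ ⊢ₚ ψ₂ → Γ ⊢ₚ pand ψ₁ ψ₂

_⊢ₜ_▹_ : Env → Tuple → Prod → Set
Γ ⊢ₜ t ▹ τ = Pointwise (λ e τ' → Γ ⊢ e ▹ τ') (toList t) (toList τ)

data _⊢w_▹_ : MType → W → Env → Set where
  tw-x : ∀ {τ n} → τ ≢ base Loc → τ ⊢w bx n ▹ [ (dv n , τ) ]
  tw-u : ∀ {n} → base Loc ⊢w bu n ▹ [ (lv n , base Loc) ]

data _⊢ws_▹_ : List MType → List W → Env → Set where
  []  : [] ⊢ws [] ▹ []
  _∷_ : ∀ {τ τs w ws Γ₁ Γ₂} → τ ⊢w w ▹ Γ₁ → τs ⊢ws ws ▹ Γ₂ →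
        (τ ∷ τs) ⊢ws (w ∷ ws) ▹ (Γ₁ ++ Γ₂)

_⊢T_▹_ : Prod → Template → Env → Set
τ ⊢T T ▹ Γ = toList τ ⊢ws toList T ▹ Γ

module Submission where

open import Defs
open import Data.Bool using (Bool; true; false)
open import Data.Bool.ListAction using (all)
open import Data.Empty using (⊥-elim)
open import Data.List using (List; []; _∷_; [_])
open import Data.List.NonEmpty using (List⁺; toList; _∷_)
open import Data.List.Relation.Binary.Pointwise using (Pointwise; []; _∷_)
open import Data.List.Relation.Binary.Subset.Propositional using (_⊆_)
open import Data.List.Relation.Unary.All using (All; []; _∷_)
open import Data.Maybe using (Maybe; just; nothing)
open import Data.Product using (_×_; Σ; _,_; proj₂)
open import Relation.Binary.PropositionalEquality using (_≡_; _≢_; refl; sym; trans)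

-- Matching a closed, operator-free, well-typed tuple against a template of
-- the same type succeeds, and the resulting substitution σ realises the
-- environment Γ produced by the template: every variable Γ assigns a type is
-- sent by σ to a closed expression evaluating to a value of that type.  A
-- substitution lemma then shows that applying such a σ to a Γ-typed
-- expression yields something that evaluates to a well-sorted value; the
-- statements for predicates and tuples follow componentwise.

≡just⇒≢nothing : ∀ {A : Set} {m : Maybe A} {x : A} → m ≡ just x → m ≢ nothing
≡just⇒≢nothing refl ()

Evaluates : Expr → MType → Set
Evaluates e τ = Σ Val λ v → (eval e ≡ just v) × (v ⊩ τ)

record Realises (Γ : Env) (σ : Subst) : Set where
  constructor realises
  field
    lookup : ∀ v τ → lookupΓ Γ v ≡ just τ →
             Σ Expr λ e → (lookupS σ v ≡ just e) × Evaluates e τ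
open Realises

realises-[] : Realises [] []
realises-[] = realises λ _ _ ()

realises-∷ : ∀ {Γ σ} w τ e → Evaluates e τ → Realises Γ σ →
             Realises ((w , τ) ∷ Γ) ((w , e) ∷ σ)
realises-∷ {Γ} {σ} w τ e e⇓ σ⊨Γ = realises lookup′
  where
    lookup′ : ∀ v τ′ → lookupΓ ((w , τ) ∷ Γ) v ≡ just τ′ →
              Σ Expr λ e′ → (lookupS ((w , e) ∷ σ) v ≡ just e′) × Evaluates e′ τ′
    lookup′ v τ′ found with w ==ᵥ v
    lookup′ v .τ refl | true = e , refl , e⇓
    ...                      | false = lookup σ⊨Γ v τ′ found

⊩ᵈ⇒dtypeOf≡ : ∀ {v τ} → v ⊩ᵈ τ → dtypeOf v ≡ τ
⊩ᵈ⇒dtypeOf≡ ws-num = refl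
⊩ᵈ⇒dtypeOf≡ ws-str = refl
⊩ᵈ⇒dtypeOf≡ ws-tid = refl
⊩ᵈ⇒dtypeOf≡ ws-loc = refl

==ᵗ-refl : ∀ τ → (τ ==ᵗ τ) ≡ true
==ᵗ-refl Int = refl
==ᵗ-refl Str = refl
==ᵗ-refl Loc = refl
==ᵗ-refl Id  = refl

All⊩ᵈ⇒allOf : ∀ {τ vs} → All (_⊩ᵈ τ) vs → allOf τ vs ≡ true
All⊩ᵈ⇒allOf []                 = refl
All⊩ᵈ⇒allOf {τ} (v⊩τ ∷ vs⊩τ)
  rewrite ⊩ᵈ⇒dtypeOf≡ v⊩τ | ==ᵗ-refl τ = All⊩ᵈ⇒allOf vs⊩τ

All⊩ᵈ⇒homogeneous : ∀ {τ vs} → All (_⊩ᵈ τ) vs → homogeneous vs ≡ true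
All⊩ᵈ⇒homogeneous []             = refl
All⊩ᵈ⇒homogeneous (v⊩τ ∷ vs⊩τ)
  rewrite ⊩ᵈ⇒dtypeOf≡ v⊩τ = All⊩ᵈ⇒allOf vs⊩τ

compareD-defined : ∀ {c τ a b} → CopOn c τ → a ⊩ᵈ τ → b ⊩ᵈ τ →
                   Σ Bool λ r → compareD c a b ≡ just r
compareD-defined eq-int ws-num ws-num = _ , refl
compareD-defined eq-str ws-str ws-str = _ , refl
compareD-defined eq-loc ws-loc ws-loc = _ , refl
compareD-defined lt-int ws-num ws-num = _ , refl
compareD-defined lt-str ws-str ws-str = _ , refl
compareD-defined le-int ws-num ws-num = _ , refl
compareD-defined le-str ws-str ws-str = _ , refl

mutual
  substE-evaluates : ∀ {Γ σ e τ} → Realises Γ σ → Γ ⊢ e ▹ τ → Evaluates (substE σ e) τ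
  substE-evaluates {σ = σ} {τ = τ} σ⊨Γ (t-x {n} found _)
    with lookupS σ (dv n) | lookup σ⊨Γ (dv n) τ found
  ... | .(just e) | e , refl , e⇓ = e⇓
  substE-evaluates {σ = σ} σ⊨Γ (t-u {n} found)
    with lookupS σ (lv n) | lookup σ⊨Γ (lv n) (base Loc) found
  ... | .(just e) | e , refl , e⇓ = e⇓
  substE-evaluates σ⊨Γ t-num = _ , refl , ws-d ws-num
  substE-evaluates σ⊨Γ t-str = _ , refl , ws-d ws-str
  substE-evaluates σ⊨Γ t-tid = _ , refl , ws-d ws-tid
  substE-evaluates σ⊨Γ t-loc = _ , refl , ws-d ws-loc
  substE-evaluates σ⊨Γ (t-cat ⊢e₁ ⊢e₂)
    with substE-evaluates σ⊨Γ ⊢e₁ | substE-evaluates σ⊨Γ ⊢e₂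
  ... | dval (vstr a) , eq₁ , ws-d ws-str | dval (vstr b) , eq₂ , ws-d ws-str
    rewrite eq₁ | eq₂ = _ , refl , ws-d ws-str
  substE-evaluates σ⊨Γ (t-aop ⊢e₁ ⊢e₂)
    with substE-evaluates σ⊨Γ ⊢e₁ | substE-evaluates σ⊨Γ ⊢e₂
  ... | dval (vnum a) , eq₁ , ws-d ws-num | dval (vnum b) , eq₂ , ws-d ws-num
    rewrite eq₁ | eq₂ = _ , refl , ws-d ws-num
  substE-evaluates σ⊨Γ (t-mset ⊢es) with substElems-evaluates σ⊨Γ ⊢es
  ... | vs , eval≡ , vs⊩τ rewrite eval≡ | All⊩ᵈ⇒homogeneous vs⊩τ = _ , refl , ws-m vs⊩τ

  substElems-evaluates : ∀ {Γ σ es τ} → Realises Γ σ → All (λ e → Γ ⊢ e ▹ base τ) es →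
                         Σ (List DVal) λ vs → (evalElems (substL σ es) ≡ just vs) × All (_⊩ᵈ τ) vs
  substElems-evaluates σ⊨Γ [] = [] , refl , []
  substElems-evaluates σ⊨Γ (⊢e ∷ ⊢es)
    with substE-evaluates σ⊨Γ ⊢e | substElems-evaluates σ⊨Γ ⊢es
  ... | dval v , eq₁ , ws-d v⊩τ | vs , eq₂ , vs⊩τ
    rewrite eq₁ | eq₂ = _ , refl , v⊩τ ∷ vs⊩τ

substP-defined : ∀ {Γ σ ψ} → Realises Γ σ → Γ ⊢ₚ ψ → Σ Bool λ b → evalP (substP σ ψ) ≡ just b
substP-defined σ⊨Γ tp-true = _ , refl
substP-defined σ⊨Γ (tp-cmp c ⊢e₁ ⊢e₂)
  with substE-evaluates σ⊨Γ ⊢e₁ | substE-evaluates σ⊨Γ ⊢e₂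
... | dval a , eq₁ , ws-d a⊩τ | dval b , eq₂ , ws-d b⊩τ
  rewrite eq₁ | eq₂ = compareD-defined c a⊩τ b⊩τ
substP-defined σ⊨Γ (tp-mem ⊢e₁ ⊢e₂)
  with substE-evaluates σ⊨Γ ⊢e₁ | substE-evaluates σ⊨Γ ⊢e₂
... | dval a , eq₁ , ws-d a⊩τ | mval ms , eq₂ , ws-m ms⊩τ
  rewrite eq₁ | eq₂ | ⊩ᵈ⇒dtypeOf≡ a⊩τ | All⊩ᵈ⇒allOf ms⊩τ = _ , refl
substP-defined σ⊨Γ (tp-not ⊢ψ) with substP-defined σ⊨Γ ⊢ψ
... | _ , eval≡ rewrite eval≡ = _ , refl
substP-defined σ⊨Γ (tp-and ⊢ψ₁ ⊢ψ₂)
  with substP-defined σ⊨Γ ⊢ψ₁ | substP-defined σ⊨Γ ⊢ψ₂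
... | _ , eq₁ | _ , eq₂ rewrite eq₁ | eq₂ = _ , refl

substL-evaluates : ∀ {Γ σ es τs} → Realises Γ σ → Pointwise (λ e τ → Γ ⊢ e ▹ τ) es τs →
                   Σ (List Val) λ vs → (evalL (substL σ es) ≡ just vs) × Pointwise _⊩_ vs τs
substL-evaluates σ⊨Γ [] = [] , refl , []
substL-evaluates σ⊨Γ (⊢e ∷ ⊢es)
  with substE-evaluates σ⊨Γ ⊢e | substL-evaluates σ⊨Γ ⊢es
... | _ , eq₁ , v⊩τ | _ , eq₂ , vs⊩τs rewrite eq₁ | eq₂ = _ , refl , v⊩τ ∷ vs⊩τs

substT-evaluates : ∀ {Γ σ t τ} → Realises Γ σ → Γ ⊢ₜ t ▹ τ →
                   Σ (List⁺ Val) λ vs → (evalT (substT σ t) ≡ just vs) × (vs ⊩ₜ τ)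
substT-evaluates {t = _ ∷ _} {τ = _ ∷ _} σ⊨Γ (⊢e ∷ ⊢es)
  with substE-evaluates σ⊨Γ ⊢e | substL-evaluates σ⊨Γ ⊢es
... | _ , eq₁ , v⊩τ | _ , eq₂ , vs⊩τs rewrite eq₁ | eq₂ = _ , refl , v⊩τ ∷ vs⊩τs

mutual
  substE-[] : ∀ e → substE [] e ≡ e
  substE-[] (num _)       = refl
  substE-[] (str _)       = refl
  substE-[] (tid _)       = refl
  substE-[] (loc _)       = refl
  substE-[] (var _)       = refl
  substE-[] (e₁ · e₂)     rewrite substE-[] e₁ | substE-[] e₂ = refl
  substE-[] (aop f e₁ e₂) rewrite substE-[] e₁ | substE-[] e₂ = refl
  substE-[] (mset es)     rewrite substL-[] es = refl

  substL-[] : ∀ es → substL [] es ≡ es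
  substL-[] []       = refl
  substL-[] (e ∷ es) rewrite substE-[] e | substL-[] es = refl

closed-evaluates : ∀ {e τ} → [] ⊢ e ▹ τ → Evaluates e τ
closed-evaluates {e} ⊢e with substE-evaluates realises-[] ⊢e
... | e⇓ rewrite substE-[] e = e⇓

constSort-closed : ∀ {e τ} → NoOp e → [] ⊢ e ▹ base τ → constSort e ≡ just τ
constSort-closed no-num t-num = refl
constSort-closed no-str t-str = refl
constSort-closed no-tid t-tid = refl
constSort-closed no-loc t-loc = refl
constSort-closed no-var (t-x () _)
constSort-closed no-var (t-u ())

all-isSort-closed : ∀ {es τ} → All NoOp es → All (λ e → [] ⊢ e ▹ base τ) es →
                    all (isSort τ) es ≡ true
all-isSort-closed []         []         = refl
all-isSort-closed {e ∷ _} {τ} (noOp ∷ noOps) (⊢e ∷ ⊢es)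
  with constSort e | constSort-closed noOp ⊢e
... | .(just τ) | refl rewrite ==ᵗ-refl τ = all-isSort-closed noOps ⊢es

isConstMset-closed : ∀ {es τ} → All NoOp es → All (λ e → [] ⊢ e ▹ base τ) es →
                     isConstMset es ≡ true
isConstMset-closed []         []         = refl
isConstMset-closed {e ∷ _} (noOp ∷ noOps) (⊢e ∷ ⊢es)
  with constSort e | constSort-closed noOp ⊢e
... | .(just _) | refl = all-isSort-closed noOps ⊢es

matchW-closed : ∀ {e τ w Γ} → NoOp e → [] ⊢ e ▹ τ → τ ⊢w w ▹ Γ →
                (matchW e w ≡ just [ (bvW w , e) ]) × (Γ ≡ [ (bvW w , τ) ])
matchW-closed no-num t-num (tw-x _)    = refl , refl
matchW-closed no-str t-str (tw-x _)    = refl , refl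
matchW-closed no-tid t-tid (tw-x _)    = refl , refl
matchW-closed no-loc t-loc (tw-x ≢Loc) = ⊥-elim (≢Loc refl)
matchW-closed no-loc t-loc tw-u        = refl , refl
matchW-closed no-var (t-x () _) _
matchW-closed no-var (t-u ()) _
matchW-closed (no-mset noOps) (t-mset ⊢es) (tw-x _)
  rewrite isConstMset-closed noOps ⊢es = refl , refl

matchL-realises : ∀ {es τs ws Γ} → All NoOp es → Pointwise (λ e τ → [] ⊢ e ▹ τ) es τs →
                  τs ⊢ws ws ▹ Γ → Σ Subst λ σ → (matchL es ws ≡ just σ) × Realises Γ σ
matchL-realises [] [] [] = [] , refl , realises-[]
matchL-realises {e ∷ _} (noOp ∷ noOps) (⊢e ∷ ⊢es) (_∷_ {w = w} ⊢w ⊢ws)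
  with matchW-closed noOp ⊢e ⊢w | matchL-realises noOps ⊢es ⊢ws
... | eq₁ , refl | σ , eq₂ , σ⊨Γ
  rewrite eq₁ | eq₂ = _ , refl , realises-∷ (bvW w) _ e (closed-evaluates ⊢e) σ⊨Γ

lemmaB10 : (t : Tuple) (τ : Prod) (T : Template) (Γ : Env) →
    All NoOp (toList t) → Linear T →
    [] ⊢ₜ t ▹ τ → τ ⊢T T ▹ Γ →
    (t / T ≢ nothing) ×
    ((σ : Subst) → t / T ≡ just σ →
      ((ψ : Pred) → Γ ⊢ₚ ψ → fvP ψ ⊆ BV T → evalP (substP σ ψ) ≢ nothing) ×
      ((t' : Tuple) (τ' : Prod) → Γ ⊢ₜ t' ▹ τ' → fvT t' ⊆ BV T →
        Σ (List⁺ Val) (λ vs → (evalT (substT σ t') ≡ just vs) × (vs ⊩ₜ τ'))))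
lemmaB10 t τ T Γ noOps _ ⊢t ⊢T with matchL-realises noOps ⊢t ⊢T
... | σ , t/T≡σ , σ⊨Γ = ≡just⇒≢nothing t/T≡σ , consequences
  where
    consequences : (σ′ : Subst) → t / T ≡ just σ′ →
      ((ψ : Pred) → Γ ⊢ₚ ψ → fvP ψ ⊆ BV T → evalP (substP σ′ ψ) ≢ nothing) ×
      ((t' : Tuple) (τ' : Prod) → Γ ⊢ₜ t' ▹ τ' → fvT t' ⊆ BV T →
        Σ (List⁺ Val) (λ vs → (evalT (substT σ′ t') ≡ just vs) × (vs ⊩ₜ τ')))
    consequences σ′ t/T≡σ′ with trans (sym t/T≡σ) t/T≡σ′
    ... | refl = (λ _ ⊢ψ _ → ≡just⇒≢nothing (proj₂ (substP-defined σ⊨Γ ⊢ψ)))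
               , (λ _ _ ⊢t′ _ → substT-evaluates σ⊨Γ ⊢t′)
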